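{- Let $G$ be a graph of order $n$ without isolated vertices. Then $$\gamma_{\rm sp}(G)\le n-\rho(G).$$
   Context: All graphs are finite, simple and undirected. For a vertex $v$, $N(v)$ is its set of neighbours and $N[v]=N(v)\cup\{v\}$; for $D\subseteq V(G)$, $\overline{D}=V(G)\setminus D$. A set $D\subseteq V(G)$ is a super dominating set of $G$ if for every $u\in\overline{D}$ there exists $v\in D$ such that $N(v)\cap\overline{D}=\{u\}$; the super domination number $\gamma_{\rm sp}(G)$ is the minimum cardinality of a super dominating set of $G$. A set $X\subseteq V(G)$ is a $2$-packing if $N[u]\cap N[v]=\emptyset$ for all distinct $u,v\in X$; the $2$-packing number $\rho(G)$ is the maximum cardinality of a $2$-packing of $G$. -}

module Defs where

open import Data.Nat using (ℕ; _≤_)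
open import Data.Bool using (Bool; true; false)
open import Data.Fin using (Fin)
open import Data.Fin.Subset using (Subset; _∈_; _∩_; _∪_; ∁; ⁅_⁆; ∣_∣; Empty)
open import Data.Vec using (tabulate)
open import Data.Product using (Σ; ∃; _×_)
open import Relation.Binary.PropositionalEquality using (_≡_; _≢_)

record Graph (n : ℕ) : Set where
  field
    adj    : Fin n → Fin n → Bool
    sym    : ∀ u v → adj u v ≡ adj v u
    irrefl : ∀ v → adj v v ≡ false
open Graph public

N : ∀ {n} → Graph n → Fin n → Subset n
N G v = tabulate (adj G v)

N[_] : ∀ {n} → Graph n → Fin n → Subset n
N[ G ] v = N G v ∪ ⁅ v ⁆

NoIsolated : ∀ {n} → Graph n → Set
NoIsolated G = ∀ v → ∃ λ u → adj G v u ≡ true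

IsSuperDominating : ∀ {n} → Graph n → Subset n → Set
IsSuperDominating G D =
  ∀ u → u ∈ ∁ D → ∃ λ v → v ∈ D × (N G v ∩ ∁ D ≡ ⁅ u ⁆)

IsSuperDominationNumber : ∀ {n} → Graph n → ℕ → Set
IsSuperDominationNumber G k =
  (∃ λ D → IsSuperDominating G D × ∣ D ∣ ≡ k) ×
  (∀ D → IsSuperDominating G D → k ≤ ∣ D ∣)

Is2Packing : ∀ {n} → Graph n → Subset n → Set
Is2Packing G X =
  ∀ u v → u ∈ X → v ∈ X → u ≢ v → Empty (N[ G ] u ∩ N[ G ] v)

IsPackingNumber : ∀ {n} → Graph n → ℕ → Set
IsPackingNumber G k =
  (∃ λ X → Is2Packing G X × ∣ X ∣ ≡ k) ×
  (∀ X → Is2Packing G X → ∣ X ∣ ≤ k)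

-- Let X be a maximum 2-packing and give every x ∈ X a neighbour ν x. The
-- closed neighbourhoods of the members of X are pairwise disjoint, so ν is
-- injective on X, its image Y misses X, and each x ∈ X has ν x as its only
-- neighbour in Y. Hence D = V ∖ Y is super dominating (u = ν x is privately
-- dominated by x), and |D| = n − |Y| = n − ρ(G).
module Submission where

open import Defs hiding (sym)
open import Data.Nat using (ℕ; _≤_; _∸_; s≤s; z≤n)
open import Data.Nat.Properties using (≤-trans; ≤-reflexive; ∸-monoʳ-≤)
open import Data.Bool using (Bool; true; false)
open import Data.Fin using (Fin; zero; suc)
open import Data.Fin.Properties using (any?; _≟_; suc-injective; 0≢1+n)
open import Data.Fin.Subset using (Subset; _∈_; _∉_; _⊆_; _∩_; ∁; ⁅_⁆; _-_; ∣_∣)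
open import Data.Fin.Subset.Properties
open import Data.Vec using (_∷_; []; tabulate; here; there)
open import Data.Vec.Properties using (lookup∘tabulate; []=⇒lookup; lookup⇒[]=)
open import Data.Product using (∃; _×_; _,_; proj₁; proj₂)
open import Data.Sum using (inj₁; inj₂)
open import Data.Empty using (⊥-elim)
open import Function using (_∘_)
open import Relation.Nullary using (yes; no; does)
open import Relation.Nullary.Decidable using (_×-dec_)
open import Relation.Binary.PropositionalEquality
  using (_≡_; _≢_; refl; sym; trans; subst)

∈-tabulate⁻ : ∀ {n} (g : Fin n → Bool) {x} → x ∈ tabulate g → g x ≡ true
∈-tabulate⁻ g {x} x∈ = trans (sym (lookup∘tabulate g x)) ([]=⇒lookup x∈)

∈-tabulate⁺ : ∀ {n} (g : Fin n → Bool) {x} → g x ≡ true → x ∈ tabulate g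
∈-tabulate⁺ g {x} gx = lookup⇒[]= x (tabulate g) (trans (lookup∘tabulate g x) gx)

∣p∣≤∣q∣-injectiveOn : ∀ {m n} {p : Subset m} {q : Subset n} (f : Fin m → Fin n) →
  (∀ {x} → x ∈ p → f x ∈ q) →
  (∀ {x y} → x ∈ p → y ∈ p → f x ≡ f y → x ≡ y) →
  ∣ p ∣ ≤ ∣ q ∣
∣p∣≤∣q∣-injectiveOn {p = []} f maps inj = z≤n
∣p∣≤∣q∣-injectiveOn {p = false ∷ p} f maps inj =
  ∣p∣≤∣q∣-injectiveOn (f ∘ suc) (maps ∘ there)
    (λ x∈ y∈ eq → suc-injective (inj (there x∈) (there y∈) eq))
∣p∣≤∣q∣-injectiveOn {p = true ∷ p} {q} f maps inj =
  ≤-trans (s≤s ∣p∣≤∣q-f₀∣) (x∈p⇒∣p-x∣<∣p∣ (maps here))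
  where
  ∣p∣≤∣q-f₀∣ : ∣ p ∣ ≤ ∣ q - f zero ∣
  ∣p∣≤∣q-f₀∣ = ∣p∣≤∣q∣-injectiveOn (f ∘ suc)
    (λ x∈ → x∈p∧x≢y⇒x∈p-y (maps (there x∈)) (0≢1+n ∘ inj here (there x∈) ∘ sym))
    (λ x∈ y∈ eq → suc-injective (inj (there x∈) (there y∈) eq))

∈∁∁⁻ : ∀ {n} {p : Subset n} {x} → x ∈ ∁ (∁ p) → x ∈ p
∈∁∁⁻ = x∉∁p⇒x∈p ∘ x∈∁p⇒x∉p

∈∁∁⁺ : ∀ {n} {p : Subset n} {x} → x ∈ p → x ∈ ∁ (∁ p)
∈∁∁⁺ = x∉p⇒x∈∁p ∘ x∈p⇒x∉∁p

image : ∀ {m n} → (Fin m → Fin n) → Subset m → Subset n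
image f p = tabulate (λ y → does (any? (λ x → (x ∈? p) ×-dec (f x ≟ y))))

module _ {m n} (f : Fin m → Fin n) (p : Subset m) where

  ∈-image⁺ : ∀ {x} → x ∈ p → f x ∈ image f p
  ∈-image⁺ {x} x∈p = ∈-tabulate⁺ _ found
    where
    found : does (any? (λ z → (z ∈? p) ×-dec (f z ≟ f x))) ≡ true
    found with any? (λ z → (z ∈? p) ×-dec (f z ≟ f x))
    ... | yes _ = refl
    ... | no ∄ = ⊥-elim (∄ (x , x∈p , refl))

  ∈-image⁻ : ∀ {y} → y ∈ image f p → ∃ λ x → x ∈ p × f x ≡ y
  ∈-image⁻ {y} y∈ with any? (λ x → (x ∈? p) ×-dec (f x ≟ y)) | ∈-tabulate⁻ _ y∈
  ... | yes witness | _ = witness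

module _ {n} (G : Graph n) where

  adj⇒∈N : ∀ {v w} → adj G v w ≡ true → w ∈ N G v
  adj⇒∈N = ∈-tabulate⁺ (adj G _)

  ∈N⇒adj : ∀ {v w} → w ∈ N G v → adj G v w ≡ true
  ∈N⇒adj = ∈-tabulate⁻ (adj G _)

  adj⇒∈N[] : ∀ {v w} → adj G v w ≡ true → w ∈ N[ G ] v
  adj⇒∈N[] = x∈p∪q⁺ ∘ inj₁ ∘ adj⇒∈N

  ∈N[]-self : ∀ v → v ∈ N[ G ] v
  ∈N[]-self v = x∈p∪q⁺ (inj₂ (x∈⁅x⁆ v))

  adj⇒≢ : ∀ {v w} → adj G v w ≡ true → v ≢ w
  adj⇒≢ {v} vw refl with () ← trans (sym vw) (irrefl G v)

  2Packing-unique : ∀ {X} → Is2Packing G X → ∀ {x y w} → x ∈ X → y ∈ X →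
    w ∈ N[ G ] x → w ∈ N[ G ] y → x ≡ y
  2Packing-unique packing {x} {y} {w} x∈X y∈X w∈x w∈y with x ≟ y
  ... | yes x≡y = x≡y
  ... | no x≢y = ⊥-elim (packing x y x∈X y∈X x≢y (w , x∈p∩q⁺ (w∈x , w∈y)))

module _ {n} (G : Graph n) (noIsolated : NoIsolated G)
         {X : Subset n} (packing : Is2Packing G X) where

  private
    ν : Fin n → Fin n
    ν v = proj₁ (noIsolated v)

    adj-ν : ∀ v → adj G v (ν v) ≡ true
    adj-ν v = proj₂ (noIsolated v)

    Y : Subset n
    Y = image ν X

    ν-injectiveOn : ∀ {x y} → x ∈ X → y ∈ X → ν x ≡ ν y → x ≡ y
    ν-injectiveOn x∈X y∈X eq = 2Packing-unique G packing x∈X y∈X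
      (adj⇒∈N[] G (adj-ν _))
      (subst (_∈ N[ G ] _) (sym eq) (adj⇒∈N[] G (adj-ν _)))

    ∈X⇒∉Y : ∀ {x} → x ∈ X → x ∉ Y
    ∈X⇒∉Y {x} x∈X x∈Y with ∈-image⁻ ν X x∈Y
    ... | y , y∈X , νy≡x = adj⇒≢ G (adj-ν y) (trans y≡x (sym νy≡x))
      where
      y≡x : _ ≡ x
      y≡x = 2Packing-unique G packing y∈X x∈X
        (subst (_∈ N[ G ] y) νy≡x (adj⇒∈N[] G (adj-ν y))) (∈N[]-self G x)

    N∩∁∁Y≡⁅ν⁆ : ∀ {x} → x ∈ X → N G x ∩ ∁ (∁ Y) ≡ ⁅ ν x ⁆
    N∩∁∁Y≡⁅ν⁆ {x} x∈X = ⊆-antisym ⊆⁅ν⁆ ⁅ν⁆⊆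
      where
      ⊆⁅ν⁆ : N G x ∩ ∁ (∁ Y) ⊆ ⁅ ν x ⁆
      ⊆⁅ν⁆ w∈ with x∈p∩q⁻ (N G x) (∁ (∁ Y)) w∈
      ... | w∈Nx , w∈∁∁Y with ∈-image⁻ ν X (∈∁∁⁻ w∈∁∁Y)
      ... | y , y∈X , refl with 2Packing-unique G packing x∈X y∈X
                                  (adj⇒∈N[] G (∈N⇒adj G w∈Nx)) (adj⇒∈N[] G (adj-ν y))
      ... | refl = x∈⁅x⁆ (ν x)

      ⁅ν⁆⊆ : ⁅ ν x ⁆ ⊆ N G x ∩ ∁ (∁ Y)
      ⁅ν⁆⊆ w∈ with refl ← x∈⁅y⁆⇒x≡y (ν x) w∈ =
        x∈p∩q⁺ (adj⇒∈N G (adj-ν x) , ∈∁∁⁺ (∈-image⁺ ν X x∈X))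

  ∁image-isSuperDominating : IsSuperDominating G (∁ Y)
  ∁image-isSuperDominating u u∈∁∁Y with ∈-image⁻ ν X (∈∁∁⁻ u∈∁∁Y)
  ... | x , x∈X , refl = x , x∉p⇒x∈∁p (∈X⇒∉Y x∈X) , N∩∁∁Y≡⁅ν⁆ x∈X

  ∣∁image∣≤n∸∣X∣ : ∣ ∁ Y ∣ ≤ n ∸ ∣ X ∣
  ∣∁image∣≤n∸∣X∣ = ≤-trans (≤-reflexive (∣∁p∣≡n∸∣p∣ Y))
    (∸-monoʳ-≤ n (∣p∣≤∣q∣-injectiveOn ν (∈-image⁺ ν X) ν-injectiveOn))

corollary14 : (n : ℕ) (G : Graph n) → NoIsolated G →
    (γsp ρ : ℕ) → IsSuperDominationNumber G γsp → IsPackingNumber G ρ →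
    γsp ≤ n ∸ ρ
corollary14 n G noIsolated γsp ρ (_ , γsp-minimal) ((X , packing , refl) , _) =
  ≤-trans (γsp-minimal _ (∁image-isSuperDominating G noIsolated packing))
          (∣∁image∣≤n∸∣X∣ G noIsolated packing)
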